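{- Let $n_1, n_2, n_3$ be pairwise coprime positive integers such that $\{\log_2 n_i\} + \{\log_2 n_j\} \ge 1$ for all $i \ne j$ in $\{1,2,3\}$ and $\{\log_2 n_1\} + \{\log_2 n_2\} + \{\log_2 n_3\} < 2$. Then \[ \mathsf{D}^{\ast}_{\pm}(C_{n_1 n_2 n_3}^2) = \mathsf{D}_{\pm}(C_{n_1 n_2 n_3}^2) = \lfloor 2 \log_2 (n_1 n_2 n_3) \rfloor + 1. \]
   Context: $C_m$ denotes a cyclic group of order $m$ and $C_m^2 = C_m \oplus C_m$; $\{x\} = x - \lfloor x\rfloor$ is the fractional part. For a finite abelian group $G$ (written additively), $\mathsf{D}_{\pm}(G)$ is the smallest positive integer $\ell$ such that for every sequence $g_1,\dots,g_k$ of elements of $G$ (repetitions allowed) with $k \ge \ell$ there exist a non-empty subset $I \subset \{1,\dots,k\}$ and $a_i \in \{+1,-1\}$ ($i\in I$) with $\sum_{i \in I} a_i g_i = 0$. Further, $\mathsf{D}^{\ast}_{\pm}(G) = \max\{ \sum_{i=1}^t \lfloor \log_2 m_i \rfloor + 1 \colon G \cong \bigoplus_{i=1}^t C_{m_i},\ t, m_i \in \mathbb{N} \}$. -}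

module Defs where

open import Data.Nat using (ℕ; suc; _+_; _*_; _∸_; _^_; _≤_; _<_; s≤s; z≤n)
open import Data.Nat.DivMod using (_%_; m%n<n)
open import Data.Nat.Logarithm using (⌊log₂_⌋)
open import Data.Fin using (Fin; toℕ; fromℕ<)
open import Data.Product using (_×_; _,_; Σ; ∃)
open import Data.List using (List; []; _∷_; map)
open import Data.Nat.ListAction using (sum)
open import Data.List.Relation.Unary.All using (All; []; _∷_)
open import Data.Vec using (Vec; []; _∷_)
open import Relation.Binary.PropositionalEquality using (_≡_; _≢_)

C : ℕ → Set
C m = Fin m

0C : ∀ {m} → C (suc m)
0C {m} = fromℕ< {0} {suc m} (s≤s z≤n)

addC : ∀ {m} → C m → C m → C m
addC {suc m} a b = fromℕ< (m%n<n (toℕ a + toℕ b) (suc m))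

negC : ∀ {m} → C m → C m
negC {suc m} a = fromℕ< (m%n<n (suc m ∸ toℕ a) (suc m))

record FinAbGroup : Set₁ where
  field
    Carrier : Set
    0G      : Carrier
    _⊕_     : Carrier → Carrier → Carrier
    neg     : Carrier → Carrier

open FinAbGroup public

-- C_m ⊕ C_m  (for m ≥ 1, written as C (suc k))
Csq : ℕ → FinAbGroup
Csq k = record
  { Carrier = C (suc k) × C (suc k)
  ; 0G      = (0C , 0C)
  ; _⊕_     = λ { (a , b) (c , d) → (addC a c , addC b d) }
  ; neg     = λ { (a , b) → (negC a , negC b) }
  }

DS : List ℕ → Set
DS ms = All C ms

addDS : ∀ {ms} → DS ms → DS ms → DS ms
addDS []       []       = []
addDS (a ∷ as) (b ∷ bs) = addC a b ∷ addDS as bs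

record IsoDS (G : FinAbGroup) (ms : List ℕ) : Set where
  field
    to      : Carrier G → DS ms
    from    : DS ms → Carrier G
    from-to : ∀ x → from (to x) ≡ x
    to-from : ∀ y → to (from y) ≡ y
    to-hom  : ∀ x y → to (_⊕_ G x y) ≡ addDS (to x) (to y)

data Sign : Set where
  s0 s+ s- : Sign

-- Σ a_i g_i where a_i ∈ {0,+1,-1}; a_i = 0 means i ∉ I.
signedSum : (G : FinAbGroup) → ∀ {k} → Vec Sign k → Vec (Carrier G) k → Carrier G
signedSum G []        []       = 0G G
signedSum G (s0 ∷ ss) (g ∷ gs) = signedSum G ss gs
signedSum G (s+ ∷ ss) (g ∷ gs) = _⊕_ G g (signedSum G ss gs)
signedSum G (s- ∷ ss) (g ∷ gs) = _⊕_ G (neg G g) (signedSum G ss gs)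

data NonTrivial : ∀ {k} → Vec Sign k → Set where
  here+ : ∀ {k} {ss : Vec Sign k} → NonTrivial (s+ ∷ ss)
  here- : ∀ {k} {ss : Vec Sign k} → NonTrivial (s- ∷ ss)
  there : ∀ {k} {s} {ss : Vec Sign k} → NonTrivial ss → NonTrivial (s ∷ ss)

PMGood : FinAbGroup → ℕ → Set
PMGood G ℓ = ∀ k → ℓ ≤ k → (gs : Vec (Carrier G) k) →
  Σ (Vec Sign k) λ ss → NonTrivial ss × signedSum G ss gs ≡ 0G G

IsDpm : FinAbGroup → ℕ → Set
IsDpm G ℓ = (1 ≤ ℓ) × PMGood G ℓ × (∀ ℓ′ → 1 ≤ ℓ′ → PMGood G ℓ′ → ℓ ≤ ℓ′)

data AllPos : List ℕ → Set where
  []  : AllPos []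
  _∷_ : ∀ {m ms} → 1 ≤ m → AllPos ms → AllPos (m ∷ ms)

logSum : List ℕ → ℕ
logSum ms = sum (map ⌊log₂_⌋ ms) + 1

IsDstar : FinAbGroup → ℕ → Set
IsDstar G ℓ =
  (∃ λ ms → AllPos ms × IsoDS G ms × logSum ms ≡ ℓ) ×
  (∀ ms → AllPos ms → IsoDS G ms → logSum ms ≤ ℓ)

-- Fractional parts of binary logarithms, expressed exactly in ℕ.
-- For positive a, b:  {log₂ a} + {log₂ b} ≥ 1
--   ⟺ log₂ (a b) ≥ ⌊log₂ a⌋ + ⌊log₂ b⌋ + 1  ⟺  2^(⌊log₂ a⌋+⌊log₂ b⌋+1) ≤ a b.
FracSum2≥1 : ℕ → ℕ → Set
FracSum2≥1 a b = 2 ^ (⌊log₂ a ⌋ + ⌊log₂ b ⌋ + 1) ≤ a * b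

-- {log₂ a} + {log₂ b} + {log₂ c} < 2  ⟺  a b c < 2^(⌊log₂ a⌋+⌊log₂ b⌋+⌊log₂ c⌋+2)
FracSum3<2 : ℕ → ℕ → ℕ → Set
FracSum3<2 a b c = a * b * c < 2 ^ (⌊log₂ a ⌋ + ⌊log₂ b ⌋ + ⌊log₂ c ⌋ + 2)

{-# OPTIONS --safe #-}
module Submission where

-- If G ≅ C_{m₁} ⊕ ⋯ ⊕ C_{mₜ}, the elements 2^j eᵢ (j < ⌊log₂ mᵢ⌋) form a sequence of
-- length Σ ⌊log₂ mᵢ⌋ with no nonempty ±-weighted zero subsum: in each coordinate such a
-- signed sum is the difference of two distinct sums of distinct powers of two, both below mᵢ.
-- So D_±(G) exceeds Σ ⌊log₂ mᵢ⌋ for every decomposition.  Conversely, a sequence of length k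
-- has 2^k subset sums; if 2^k > |G| two of them coincide, and their difference is a
-- ±-weighted zero subsum.  Hence a decomposition with |G| < 2^(Σ ⌊log₂ mᵢ⌋ + 1) determines
-- both D*_±(G) and D_±(G).  For G = C_N² with N = n₁n₂n₃, the Chinese remainder theorem gives
-- G ≅ C_{n₁n₂} ⊕ C_{n₁n₃} ⊕ C_{n₂n₃}; the pairwise conditions say
-- ⌊log₂ nᵢnⱼ⌋ = ⌊log₂ nᵢ⌋ + ⌊log₂ nⱼ⌋ + 1, so these three logarithms sum to
-- 2(⌊log₂ n₁⌋ + ⌊log₂ n₂⌋ + ⌊log₂ n₃⌋) + 3, and the triple condition says N² < 2^(that sum + 1).

open import Defs
open import Level using (0ℓ)
open import Algebra.Bundles using (AbelianGroup)
open import Algebra.Core using (Op₁; Op₂)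
open import Algebra.Definitions using (Associative; Commutative; LeftIdentity; LeftInverse)
open import Algebra.Structures using (IsAbelianGroup)
open import Algebra.Consequences.Propositional using (comm∧idˡ⇒id; comm∧invˡ⇒inv)
import Algebra.Properties.AbelianGroup as AbelianGroupProperties
import Algebra.Properties.CommutativeSemigroup as CommutativeSemigroupProperties
open import Data.Nat using (ℕ; zero; suc; _*_; _+_; _∸_; _≤_; _<_; s≤s; z≤n; _^_; ⌊_/2⌋; ⌈_/2⌉)
open import Data.Nat.Properties
open import Data.Nat.DivMod using (_%_; _/_; m%n<n; %-distribˡ-+; n%n≡0; m<n⇒m%n≡m; m≡m%n+[m/n]*n; %-remove-+ʳ)
open import Data.Nat.Divisibility
  using (_∣_; divides; quotient; m∣n⇒n≡quotient*m; ∣n⇒∣m*n; m∣m*n; n∣m*n; m%n≡0⇒n∣m; ∣m+n∣m⇒∣n; ∣-trans; >⇒∤)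
open import Data.Nat.Coprimality using (Coprime; coprime-divisor)
import Data.Nat.Coprimality as Coprime
open import Data.Nat.Logarithm using (⌊log₂_⌋; ⌊log₂⌋-mono-≤; ⌊log₂⌊n/2⌋⌋≡⌊log₂n⌋∸1; ⌊log₂[2^n]⌋≡n)
open import Data.Nat.ListAction using (sum; product)
open import Data.Nat.Tactic.RingSolver using (solve-∀)
open import Data.Fin using (Fin; toℕ; fromℕ<; remQuot; combine; punchOut)
open import Data.Fin.Patterns using (0F; 1F)
open import Data.Fin.Properties
  using (toℕ-fromℕ<; fromℕ<-cong; fromℕ<-toℕ; toℕ<n; toℕ-injective; combine-remQuot; combine-injective;
         pigeonhole; any?; punchOut-injective; injective⇒≤)
import Data.Fin.Properties as Fin
open import Data.List using (List; []; _∷_)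
import Data.List as List
open import Data.List.Relation.Unary.All using ([]; _∷_; head; tail)
open import Data.Vec using (Vec; []; _∷_; map; _++_; splitAt; zipWith)
import Data.Vec as Vec
open import Data.Vec.Properties using (map-∘; map-cong; map-id)
open import Data.Product using (_×_; _,_; proj₁; proj₂; uncurry; Σ; ∃)
open import Data.Sum using (_⊎_; inj₁; inj₂)
open import Function using (_∘_)
open import Function.Definitions using (Injective)
open import Relation.Binary.PropositionalEquality
open import Relation.Nullary using (yes; no; contradiction)


-- Abelian group structure of cyclic groups and their direct sums

isAbelianGroup-≡ : {A : Set} {_∙_ : Op₂ A} {ε : A} {_⁻¹ : Op₁ A} →
  Associative _≡_ _∙_ → Commutative _≡_ _∙_ →
  LeftIdentity _≡_ ε _∙_ → LeftInverse _≡_ ε _⁻¹ _∙_ →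
  IsAbelianGroup _≡_ _∙_ ε _⁻¹
isAbelianGroup-≡ {_∙_ = _∙_} {_⁻¹ = _⁻¹} assoc comm idˡ invˡ = record
  { isGroup = record
    { isMonoid = record
      { isSemigroup = record { isMagma = record { isEquivalence = isEquivalence ; ∙-cong = cong₂ _∙_ } ; assoc = assoc }
      ; identity = comm∧idˡ⇒id comm idˡ
      }
    ; inverse = comm∧invˡ⇒inv comm invˡ
    ; ⁻¹-cong = cong _⁻¹
    }
  ; comm = comm
  }

IsAbelian : FinAbGroup → Set
IsAbelian G = IsAbelianGroup _≡_ (_⊕_ G) (0G G) (neg G)

abelianGroup : (G : FinAbGroup) → IsAbelian G → AbelianGroup 0ℓ 0ℓ
abelianGroup G isAb = record { isAbelianGroup = isAb }

module _ {m : ℕ} where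

  ι : ℕ → C (suc m)
  ι x = fromℕ< (m%n<n x (suc m))

  ι-≡ : ∀ x y → x % suc m ≡ y % suc m → ι x ≡ ι y
  ι-≡ x y eq = fromℕ<-cong _ _ eq _ _

  ι-toℕ : ∀ a → ι (toℕ a) ≡ a
  ι-toℕ a = trans (fromℕ<-cong _ _ (m<n⇒m%n≡m (toℕ<n a)) _ (toℕ<n a)) (fromℕ<-toℕ a _)

  ι-injective-< : ∀ {x y} → x < suc m → y < suc m → ι x ≡ ι y → x ≡ y
  ι-injective-< {x} {y} x< y< ιx≡ιy = begin
    x            ≡⟨ m<n⇒m%n≡m x< ⟨
    x % suc m    ≡⟨ toℕ-fromℕ< (m%n<n x (suc m)) ⟨
    toℕ (ι x)    ≡⟨ cong toℕ ιx≡ιy ⟩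
    toℕ (ι y)    ≡⟨ toℕ-fromℕ< (m%n<n y (suc m)) ⟩
    y % suc m    ≡⟨ m<n⇒m%n≡m y< ⟩
    y            ∎
    where open ≡-Reasoning

  ι≡0C⇒∣ : ∀ x → ι x ≡ 0C → suc m ∣ x
  ι≡0C⇒∣ x ιx≡0 = m%n≡0⇒n∣m x (suc m) (trans (sym (toℕ-fromℕ< (m%n<n x (suc m)))) (cong toℕ ιx≡0))

  ι-+ : ∀ x y → ι (x + y) ≡ addC (ι x) (ι y)
  ι-+ x y = begin
    ι (x + y)                          ≡⟨ ι-≡ (x + y) (x % suc m + y % suc m) (%-distribˡ-+ x y (suc m)) ⟩
    ι (x % suc m + y % suc m)
      ≡⟨ cong₂ (λ a b → ι (a + b)) (toℕ-fromℕ< (m%n<n x (suc m))) (toℕ-fromℕ< (m%n<n y (suc m))) ⟨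
    ι (toℕ (ι x) + toℕ (ι y))          ∎
    where open ≡-Reasoning

  addC-assoc : Associative _≡_ (addC {suc m})
  addC-assoc a b c = begin
    addC (addC a b) c                  ≡⟨ cong (addC (addC a b)) (ι-toℕ c) ⟨
    addC (ι (toℕ a + toℕ b)) (ι (toℕ c)) ≡⟨ ι-+ (toℕ a + toℕ b) (toℕ c) ⟨
    ι (toℕ a + toℕ b + toℕ c)          ≡⟨ cong ι (+-assoc (toℕ a) _ _) ⟩
    ι (toℕ a + (toℕ b + toℕ c))        ≡⟨ ι-+ (toℕ a) (toℕ b + toℕ c) ⟩
    addC (ι (toℕ a)) (addC b c)        ≡⟨ cong (λ z → addC z _) (ι-toℕ a) ⟩
    addC a (addC b c)                  ∎
    where open ≡-Reasoning

  addC-comm : Commutative _≡_ (addC {suc m})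
  addC-comm a b = cong ι (+-comm (toℕ a) (toℕ b))

  addC-identityˡ : LeftIdentity _≡_ 0C (addC {suc m})
  addC-identityˡ = ι-toℕ

  negC-inverseˡ : LeftInverse _≡_ 0C negC (addC {suc m})
  negC-inverseˡ a = begin
    addC (negC a) a                    ≡⟨ cong (addC (negC a)) (ι-toℕ a) ⟨
    addC (ι (suc m ∸ toℕ a)) (ι (toℕ a)) ≡⟨ ι-+ (suc m ∸ toℕ a) (toℕ a) ⟨
    ι (suc m ∸ toℕ a + toℕ a)          ≡⟨ cong ι (m∸n+n≡m (<⇒≤ (toℕ<n a))) ⟩
    ι (suc m)                          ≡⟨ ι-≡ (suc m) 0 (n%n≡0 (suc m)) ⟩
    0C                                 ∎
    where open ≡-Reasoning

CG : ℕ → FinAbGroup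
CG m = record { Carrier = C (suc m) ; 0G = 0C ; _⊕_ = addC ; neg = negC }

C-isAbelian : ∀ m → IsAbelian (CG m)
C-isAbelian m = isAbelianGroup-≡ addC-assoc addC-comm addC-identityˡ negC-inverseˡ

Csq-isAbelian : ∀ k → IsAbelian (Csq k)
Csq-isAbelian k = isAbelianGroup-≡
  (λ (a , b) (c , d) (e , f) → cong₂ _,_ (Cₖ.assoc a c e) (Cₖ.assoc b d f))
  (λ (a , b) (c , d) → cong₂ _,_ (Cₖ.comm a c) (Cₖ.comm b d))
  (λ (a , b) → cong₂ _,_ (Cₖ.identityˡ a) (Cₖ.identityˡ b))
  (λ (a , b) → cong₂ _,_ (Cₖ.inverseˡ a) (Cₖ.inverseˡ b))
  where module Cₖ = IsAbelianGroup (C-isAbelian k)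

zeroDS : ∀ {ms} → AllPos ms → DS ms
zeroDS []            = []
zeroDS (s≤s z≤n ∷ p) = 0C ∷ zeroDS p

negDS : ∀ {ms} → DS ms → DS ms
negDS []       = []
negDS (a ∷ as) = negC a ∷ negDS as

DSG : (ms : List ℕ) → AllPos ms → FinAbGroup
DSG ms p = record { Carrier = DS ms ; 0G = zeroDS p ; _⊕_ = addDS ; neg = negDS }

module _ where
  open IsAbelianGroup using (assoc; comm; identityˡ; inverseˡ)

  addDS-assoc : ∀ {ms} → AllPos ms → Associative _≡_ (addDS {ms})
  addDS-assoc [] [] [] [] = refl
  addDS-assoc (s≤s {n = m} z≤n ∷ p) (a ∷ x) (b ∷ y) (c ∷ z) =
    cong₂ _∷_ (assoc (C-isAbelian m) a b c) (addDS-assoc p x y z)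

  addDS-comm : ∀ {ms} → AllPos ms → Commutative _≡_ (addDS {ms})
  addDS-comm [] [] [] = refl
  addDS-comm (s≤s {n = m} z≤n ∷ p) (a ∷ x) (b ∷ y) = cong₂ _∷_ (comm (C-isAbelian m) a b) (addDS-comm p x y)

  addDS-identityˡ : ∀ {ms} (p : AllPos ms) → LeftIdentity _≡_ (zeroDS p) addDS
  addDS-identityˡ [] [] = refl
  addDS-identityˡ (s≤s {n = m} z≤n ∷ p) (a ∷ x) = cong₂ _∷_ (identityˡ (C-isAbelian m) a) (addDS-identityˡ p x)

  negDS-inverseˡ : ∀ {ms} (p : AllPos ms) → LeftInverse _≡_ (zeroDS p) negDS addDS
  negDS-inverseˡ [] [] = refl
  negDS-inverseˡ (s≤s {n = m} z≤n ∷ p) (a ∷ x) = cong₂ _∷_ (inverseˡ (C-isAbelian m) a) (negDS-inverseˡ p x)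

DS-isAbelian : ∀ {ms} (p : AllPos ms) → IsAbelian (DSG ms p)
DS-isAbelian p = isAbelianGroup-≡ (addDS-assoc p) (addDS-comm p) (addDS-identityˡ p) (negDS-inverseˡ p)

module Homomorphism {G H : FinAbGroup} (G-ab : IsAbelian G) (H-ab : IsAbelian H)
  (h : Carrier G → Carrier H) (h-⊕ : ∀ x y → h (_⊕_ G x y) ≡ _⊕_ H (h x) (h y)) where

  private
    module GA = IsAbelianGroup G-ab
    module HP = AbelianGroupProperties (abelianGroup H H-ab)

  h-0 : h (0G G) ≡ 0G H
  h-0 = HP.identityˡ-unique (h (0G G)) (h (0G G)) (trans (sym (h-⊕ _ _)) (cong h (GA.identityˡ (0G G))))

  h-neg : ∀ x → h (neg G x) ≡ neg H (h x)
  h-neg x = HP.inverseˡ-unique (h (neg G x)) (h x) (trans (sym (h-⊕ _ _)) (trans (cong h (GA.inverseˡ x)) h-0))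

  signedSum-homo : ∀ {k} (ss : Vec Sign k) gs → h (signedSum G ss gs) ≡ signedSum H ss (map h gs)
  signedSum-homo []        []       = h-0
  signedSum-homo (s0 ∷ ss) (g ∷ gs) = signedSum-homo ss gs
  signedSum-homo (s+ ∷ ss) (g ∷ gs) = trans (h-⊕ _ _) (cong (_⊕_ H (h g)) (signedSum-homo ss gs))
  signedSum-homo (s- ∷ ss) (g ∷ gs) = trans (h-⊕ _ _) (cong₂ (_⊕_ H) (h-neg g) (signedSum-homo ss gs))

  trivialKernel⇒injective : (∀ x → h x ≡ 0G H → x ≡ 0G G) → Injective _≡_ _≡_ h
  trivialKernel⇒injective ker {x} {y} hx≡hy = GP.x∙y⁻¹≈ε⇒x≈y x y (ker _ (begin
    h (_⊕_ G x (neg G y))          ≡⟨ h-⊕ x (neg G y) ⟩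
    _⊕_ H (h x) (h (neg G y))      ≡⟨ cong₂ (_⊕_ H) hx≡hy (h-neg y) ⟩
    _⊕_ H (h y) (neg H (h y))      ≡⟨ HA.inverseʳ (h y) ⟩
    0G H                           ∎))
    where
    open ≡-Reasoning
    module GP = AbelianGroupProperties (abelianGroup G G-ab)
    module HA = IsAbelianGroup H-ab


-- Signed sums and zero-sum-free sequences

NonTrivial-++⁻ : ∀ {j l} (ss₁ : Vec Sign j) {ss₂ : Vec Sign l} →
  NonTrivial (ss₁ ++ ss₂) → NonTrivial ss₁ ⊎ NonTrivial ss₂
NonTrivial-++⁻ []         nt         = inj₂ nt
NonTrivial-++⁻ (s+ ∷ ss₁) _          = inj₁ here+
NonTrivial-++⁻ (s- ∷ ss₁) _          = inj₁ here-
NonTrivial-++⁻ (s0 ∷ ss₁) (there nt) with NonTrivial-++⁻ ss₁ nt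
... | inj₁ nt₁ = inj₁ (there nt₁)
... | inj₂ nt₂ = inj₂ nt₂

module _ {G : FinAbGroup} (G-ab : IsAbelian G) where
  open IsAbelianGroup G-ab using (assoc; identityˡ)

  signedSum-++ : ∀ {j l} (ss₁ : Vec Sign j) (ss₂ : Vec Sign l) xs ys →
    signedSum G (ss₁ ++ ss₂) (xs ++ ys) ≡ _⊕_ G (signedSum G ss₁ xs) (signedSum G ss₂ ys)
  signedSum-++ []         ss₂ []       ys = sym (identityˡ _)
  signedSum-++ (s0 ∷ ss₁) ss₂ (x ∷ xs) ys = signedSum-++ ss₁ ss₂ xs ys
  signedSum-++ (s+ ∷ ss₁) ss₂ (x ∷ xs) ys =
    trans (cong (_⊕_ G x) (signedSum-++ ss₁ ss₂ xs ys)) (sym (assoc x _ _))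
  signedSum-++ (s- ∷ ss₁) ss₂ (x ∷ xs) ys =
    trans (cong (_⊕_ G (neg G x)) (signedSum-++ ss₁ ss₂ xs ys)) (sym (assoc (neg G x) _ _))

ZeroSumFree : (G : FinAbGroup) → ∀ {t} → Vec (Carrier G) t → Set
ZeroSumFree G gs = ∀ ss → NonTrivial ss → signedSum G ss gs ≢ 0G G

PMGood⇒length< : ∀ {G ℓ t} {gs : Vec (Carrier G) t} → PMGood G ℓ → ZeroSumFree G gs → t < ℓ
PMGood⇒length< {t = t} {gs} good free with t <? _
... | yes t<ℓ = t<ℓ
... | no  t≮ℓ = let ss , nt , sum≡0 = good t (≮⇒≥ t≮ℓ) gs in contradiction sum≡0 (free ss nt)

ZeroSumFree-transport : ∀ {G ms t} {xs : Vec (DS ms) t} →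
  IsAbelian G → (p : AllPos ms) → (iso : IsoDS G ms) → ZeroSumFree (DSG ms p) xs →
  ZeroSumFree G (map (IsoDS.from iso) xs)
ZeroSumFree-transport {G} {ms} {xs = xs} G-ab p iso free ss nt sum≡0 = free ss nt (begin
  signedSum (DSG ms p) ss xs                  ≡⟨ cong (signedSum (DSG ms p) ss) to∘from≡id ⟨
  signedSum (DSG ms p) ss (map to (map from xs)) ≡⟨ signedSum-homo ss (map from xs) ⟨
  to (signedSum G ss (map from xs))           ≡⟨ cong to sum≡0 ⟩
  to (0G G)                                   ≡⟨ h-0 ⟩
  zeroDS p                                    ∎)
  where
  open ≡-Reasoning
  open IsoDS iso
  open Homomorphism G-ab (DS-isAbelian p) to to-hom
  to∘from≡id : map to (map from xs) ≡ xs
  to∘from≡id = trans (sym (map-∘ to from xs)) (trans (map-cong to-from xs) (map-id xs))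


-- Binary logarithms

2^⌊log₂n⌋≤n : ∀ {n} → 1 ≤ n → 2 ^ ⌊log₂ n ⌋ ≤ n
2^⌊log₂n⌋≤n {n} 1≤n = ⌊log₂n⌋≡t⇒2^t≤n ⌊log₂ n ⌋ n 1≤n refl
  where
  2*⌊n/2⌋≤n : ∀ n → 2 * ⌊ n /2⌋ ≤ n
  2*⌊n/2⌋≤n n = begin
    ⌊ n /2⌋ + (⌊ n /2⌋ + 0) ≡⟨ cong (⌊ n /2⌋ +_) (+-identityʳ _) ⟩
    ⌊ n /2⌋ + ⌊ n /2⌋       ≤⟨ +-monoʳ-≤ ⌊ n /2⌋ (⌊n/2⌋≤⌈n/2⌉ n) ⟩
    ⌊ n /2⌋ + ⌈ n /2⌉       ≡⟨ ⌊n/2⌋+⌈n/2⌉≡n n ⟩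
    n                       ∎
    where open ≤-Reasoning
  ⌊log₂n⌋≡t⇒2^t≤n : ∀ t n → 1 ≤ n → ⌊log₂ n ⌋ ≡ t → 2 ^ t ≤ n
  ⌊log₂n⌋≡t⇒2^t≤n zero    n             1≤n _ = 1≤n
  ⌊log₂n⌋≡t⇒2^t≤n (suc t) (suc zero)    _   ()
  ⌊log₂n⌋≡t⇒2^t≤n (suc t) (suc (suc y)) _   log≡ = begin
    2 * 2 ^ t          ≤⟨ *-monoʳ-≤ 2 (⌊log₂n⌋≡t⇒2^t≤n t (suc ⌊ y /2⌋) (s≤s z≤n) log-half≡) ⟩
    2 * suc ⌊ y /2⌋    ≤⟨ 2*⌊n/2⌋≤n (suc (suc y)) ⟩
    suc (suc y)        ∎
    where
    open ≤-Reasoning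
    log-half≡ : ⌊log₂ suc ⌊ y /2⌋ ⌋ ≡ t
    log-half≡ = trans (⌊log₂⌊n/2⌋⌋≡⌊log₂n⌋∸1 (suc (suc y))) (cong (_∸ 1) log≡)

n<2^[1+⌊log₂n⌋] : ∀ n → n < 2 ^ suc ⌊log₂ n ⌋
n<2^[1+⌊log₂n⌋] n = ≰⇒> λ 2^[1+L]≤n →
  1+n≰n (subst (_≤ ⌊log₂ n ⌋) (⌊log₂[2^n]⌋≡n (suc ⌊log₂ n ⌋)) (⌊log₂⌋-mono-≤ 2^[1+L]≤n))

2^t≤n<2^[1+t]⇒⌊log₂n⌋≡t : ∀ {n t} → 2 ^ t ≤ n → n < 2 ^ suc t → ⌊log₂ n ⌋ ≡ t
2^t≤n<2^[1+t]⇒⌊log₂n⌋≡t {n} {t} 2^t≤n n<2^[1+t] = ≤-antisym log≤t t≤log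
  where
  t≤log : t ≤ ⌊log₂ n ⌋
  t≤log = subst (_≤ ⌊log₂ n ⌋) (⌊log₂[2^n]⌋≡n t) (⌊log₂⌋-mono-≤ 2^t≤n)
  log≤t : ⌊log₂ n ⌋ ≤ t
  log≤t = ≮⇒≥ λ t<log → <⇒≱ n<2^[1+t]
    (≤-trans (^-monoʳ-≤ 2 t<log) (2^⌊log₂n⌋≤n (≤-trans (m^n>0 2 t) 2^t≤n)))

⌊log₂[xy]⌋≡⌊log₂x⌋+⌊log₂y⌋+1 : ∀ x y → FracSum2≥1 x y →
  ⌊log₂ (x * y) ⌋ ≡ ⌊log₂ x ⌋ + ⌊log₂ y ⌋ + 1
⌊log₂[xy]⌋≡⌊log₂x⌋+⌊log₂y⌋+1 x y carry = 2^t≤n<2^[1+t]⇒⌊log₂n⌋≡t carry (begin-strict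
  x * y                                   <⟨ *-mono-< (n<2^[1+⌊log₂n⌋] x) (n<2^[1+⌊log₂n⌋] y) ⟩
  2 ^ suc ⌊log₂ x ⌋ * 2 ^ suc ⌊log₂ y ⌋   ≡⟨ ^-distribˡ-+-* 2 (suc ⌊log₂ x ⌋) (suc ⌊log₂ y ⌋) ⟨
  2 ^ (suc ⌊log₂ x ⌋ + suc ⌊log₂ y ⌋)     ≡⟨ cong (2 ^_) (exponent ⌊log₂ x ⌋ ⌊log₂ y ⌋) ⟩
  2 ^ suc (⌊log₂ x ⌋ + ⌊log₂ y ⌋ + 1)     ∎)
  where
  open ≤-Reasoning
  exponent : ∀ a b → suc a + suc b ≡ suc (a + b + 1)
  exponent = solve-∀

sumLog₂ : List ℕ → ℕ
sumLog₂ ms = sum (List.map ⌊log₂_⌋ ms)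

2^sumLog₂≤product : ∀ {ms} → AllPos ms → 2 ^ sumLog₂ ms ≤ product ms
2^sumLog₂≤product []                     = ≤-refl
2^sumLog₂≤product {m ∷ ms} (1≤m ∷ p) = begin
  2 ^ (⌊log₂ m ⌋ + sumLog₂ ms)       ≡⟨ ^-distribˡ-+-* 2 ⌊log₂ m ⌋ (sumLog₂ ms) ⟩
  2 ^ ⌊log₂ m ⌋ * 2 ^ sumLog₂ ms     ≤⟨ *-mono-≤ (2^⌊log₂n⌋≤n 1≤m) (2^sumLog₂≤product p) ⟩
  m * product ms                     ∎
  where open ≤-Reasoning

⌊log₂[n₁n₂n₃]²⌋≡sumLog₂ : ∀ {n₁ n₂ n₃} → 1 ≤ n₁ → 1 ≤ n₂ → 1 ≤ n₃ →
  FracSum2≥1 n₁ n₂ → FracSum2≥1 n₁ n₃ → FracSum2≥1 n₂ n₃ → FracSum3<2 n₁ n₂ n₃ →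
  ⌊log₂ (n₁ * n₂ * n₃ * (n₁ * n₂ * n₃)) ⌋ ≡ sumLog₂ (n₁ * n₂ ∷ n₁ * n₃ ∷ n₂ * n₃ ∷ [])
⌊log₂[n₁n₂n₃]²⌋≡sumLog₂ {n₁} {n₂} {n₃} 1≤n₁ 1≤n₂ 1≤n₃ carry₁₂ carry₁₃ carry₂₃ N<2^s =
  2^t≤n<2^[1+t]⇒⌊log₂n⌋≡t lower upper
  where
  l₁ = ⌊log₂ n₁ ⌋
  l₂ = ⌊log₂ n₂ ⌋
  l₃ = ⌊log₂ n₃ ⌋
  N = n₁ * n₂ * n₃
  ms = n₁ * n₂ ∷ n₁ * n₃ ∷ n₂ * n₃ ∷ []
  lower : 2 ^ sumLog₂ ms ≤ N * N
  lower = ≤-trans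
    (2^sumLog₂≤product (*-mono-≤ 1≤n₁ 1≤n₂ ∷ *-mono-≤ 1≤n₁ 1≤n₃ ∷ *-mono-≤ 1≤n₂ 1≤n₃ ∷ []))
    (≤-reflexive (square n₁ n₂ n₃))
    where
    square : ∀ x y z → x * y * (x * z * (y * z * 1)) ≡ x * y * z * (x * y * z)
    square = solve-∀
  sumLog₂≡ : sumLog₂ ms ≡ (l₁ + l₂ + 1) + ((l₁ + l₃ + 1) + ((l₂ + l₃ + 1) + 0))
  sumLog₂≡ = cong₂ _+_ (⌊log₂[xy]⌋≡⌊log₂x⌋+⌊log₂y⌋+1 n₁ n₂ carry₁₂)
    (cong₂ _+_ (⌊log₂[xy]⌋≡⌊log₂x⌋+⌊log₂y⌋+1 n₁ n₃ carry₁₃)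
               (cong (_+ 0) (⌊log₂[xy]⌋≡⌊log₂x⌋+⌊log₂y⌋+1 n₂ n₃ carry₂₃)))
  upper : N * N < 2 ^ suc (sumLog₂ ms)
  upper = begin-strict
    N * N                                   <⟨ *-mono-< N<2^s N<2^s ⟩
    2 ^ (l₁ + l₂ + l₃ + 2) * 2 ^ (l₁ + l₂ + l₃ + 2) ≡⟨ ^-distribˡ-+-* 2 (l₁ + l₂ + l₃ + 2) _ ⟨
    2 ^ ((l₁ + l₂ + l₃ + 2) + (l₁ + l₂ + l₃ + 2))  ≡⟨ cong (2 ^_) (exponent l₁ l₂ l₃) ⟩
    2 ^ suc ((l₁ + l₂ + 1) + ((l₁ + l₃ + 1) + ((l₂ + l₃ + 1) + 0))) ≡⟨ cong (λ e → 2 ^ suc e) sumLog₂≡ ⟨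
    2 ^ suc (sumLog₂ ms)                    ∎
    where
    open ≤-Reasoning
    exponent : ∀ a b c → (a + b + c + 2) + (a + b + c + 2) ≡ suc ((a + b + 1) + ((a + c + 1) + ((b + c + 1) + 0)))
    exponent = solve-∀


-- Signed sums of powers of two

powersOfTwo : ∀ {m} j → Vec (C (suc m)) j
powersOfTwo zero    = []
powersOfTwo (suc j) = ι (2 ^ j) ∷ powersOfTwo j

-- The positive and negative parts of Σᵢ sᵢ 2^(j-1-i), matching the order of powersOfTwo j.
posWeight negWeight : ∀ {j} → Vec Sign j → ℕ
posWeight []                = 0
posWeight {suc j} (s+ ∷ ss) = 2 ^ j + posWeight ss
posWeight (s0 ∷ ss)         = posWeight ss
posWeight (s- ∷ ss)         = posWeight ss
negWeight []                = 0
negWeight {suc j} (s- ∷ ss) = 2 ^ j + negWeight ss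
negWeight (s0 ∷ ss)         = negWeight ss
negWeight (s+ ∷ ss)         = negWeight ss

weights<2^ : ∀ {j} (ss : Vec Sign j) → posWeight ss < 2 ^ j × negWeight ss < 2 ^ j
weights<2^ []               = s≤s z≤n , s≤s z≤n
weights<2^ {suc j} (s ∷ ss) = step s
  where
  p< = proj₁ (weights<2^ ss)
  n< = proj₂ (weights<2^ ss)
  without : ∀ {x} → x < 2 ^ j → x < 2 ^ suc j
  without x< = <-≤-trans x< (m≤m+n (2 ^ j) _)
  with2^j : ∀ {x} → x < 2 ^ j → 2 ^ j + x < 2 ^ suc j
  with2^j x< = +-monoʳ-< (2 ^ j) (<-≤-trans x< (m≤m+n (2 ^ j) 0))
  step : ∀ s → posWeight (s ∷ ss) < 2 ^ suc j × negWeight (s ∷ ss) < 2 ^ suc j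
  step s0 = without p< , without n<
  step s+ = with2^j p< , without n<
  step s- = without p< , with2^j n<

posWeight≢negWeight : ∀ {j} (ss : Vec Sign j) → NonTrivial ss → posWeight ss ≢ negWeight ss
posWeight≢negWeight {suc j} (s+ ∷ ss) _ p≡n =
  <⇒≱ (proj₂ (weights<2^ ss)) (subst (2 ^ j ≤_) p≡n (m≤m+n (2 ^ j) _))
posWeight≢negWeight {suc j} (s- ∷ ss) _ p≡n =
  <⇒≱ (proj₁ (weights<2^ ss)) (subst (2 ^ j ≤_) (sym p≡n) (m≤m+n (2 ^ j) _))
posWeight≢negWeight (s0 ∷ ss) (there nt) = posWeight≢negWeight ss nt

module _ {m : ℕ} where
  open IsAbelianGroup (C-isAbelian m) using (assoc; identityˡ; inverseˡ)
  open CommutativeSemigroupProperties (AbelianGroup.commutativeSemigroup (abelianGroup (CG m) (C-isAbelian m)))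
    using (interchange)

  signedSum-powersOfTwo : ∀ {j} (ss : Vec Sign j) →
    addC (signedSum (CG m) ss (powersOfTwo j)) (ι (negWeight ss)) ≡ ι (posWeight ss)
  signedSum-powersOfTwo []                = identityˡ 0C
  signedSum-powersOfTwo (s0 ∷ ss)         = signedSum-powersOfTwo ss
  signedSum-powersOfTwo {suc j} (s+ ∷ ss) = begin
    addC (addC (ι (2 ^ j)) S) (ι N)         ≡⟨ assoc (ι (2 ^ j)) S (ι N) ⟩
    addC (ι (2 ^ j)) (addC S (ι N))         ≡⟨ cong (addC (ι (2 ^ j))) (signedSum-powersOfTwo ss) ⟩
    addC (ι (2 ^ j)) (ι (posWeight ss))     ≡⟨ ι-+ (2 ^ j) (posWeight ss) ⟨
    ι (2 ^ j + posWeight ss)                ∎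
    where
    open ≡-Reasoning
    S = signedSum (CG m) ss (powersOfTwo j)
    N = negWeight ss
  signedSum-powersOfTwo {suc j} (s- ∷ ss) = begin
    addC (addC (negC g) S) (ι (2 ^ j + N))  ≡⟨ cong (addC (addC (negC g) S)) (ι-+ (2 ^ j) N) ⟩
    addC (addC (negC g) S) (addC g (ι N))   ≡⟨ interchange (negC g) S g (ι N) ⟩
    addC (addC (negC g) g) (addC S (ι N))   ≡⟨ cong₂ addC (inverseˡ g) (signedSum-powersOfTwo ss) ⟩
    addC 0C (ι (posWeight ss))              ≡⟨ identityˡ (ι (posWeight ss)) ⟩
    ι (posWeight ss)                        ∎
    where
    open ≡-Reasoning
    g = ι (2 ^ j)
    S = signedSum (CG m) ss (powersOfTwo j)
    N = negWeight ss

  powersOfTwo-zeroSumFree : ∀ j → 2 ^ j ≤ suc m → ZeroSumFree (CG m) (powersOfTwo j)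
  powersOfTwo-zeroSumFree j 2^j≤ ss nt sum≡0 = posWeight≢negWeight ss nt (ι-injective-<
    (<-≤-trans (proj₁ (weights<2^ ss)) 2^j≤) (<-≤-trans (proj₂ (weights<2^ ss)) 2^j≤) (begin
      ι (posWeight ss)                                              ≡⟨ signedSum-powersOfTwo ss ⟨
      addC (signedSum (CG m) ss (powersOfTwo j)) (ι (negWeight ss)) ≡⟨ cong (λ z → addC z (ι (negWeight ss))) sum≡0 ⟩
      addC 0C (ι (negWeight ss))                                    ≡⟨ identityˡ (ι (negWeight ss)) ⟩
      ι (negWeight ss)                                              ∎))
    where open ≡-Reasoning

binarySequence : ∀ ms → AllPos ms → Vec (DS ms) (sumLog₂ ms)
binarySequence []                [] = []
binarySequence (.(suc m) ∷ ms) (s≤s {n = m} z≤n ∷ p) =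
  map (_∷ zeroDS p) (powersOfTwo ⌊log₂ suc m ⌋) ++ map (0C ∷_) (binarySequence ms p)

module _ {m : ℕ} {ms : List ℕ} (p : AllPos ms) where
  private
    G = DSG (suc m ∷ ms) (s≤s z≤n ∷ p)
    module Cₘ = IsAbelianGroup (C-isAbelian m)
    module DS = IsAbelianGroup (DS-isAbelian p)
    module Head = Homomorphism (C-isAbelian m) (DS-isAbelian (s≤s z≤n ∷ p)) (_∷ zeroDS p)
      (λ a b → cong (addC a b ∷_) (sym (DS.identityˡ (zeroDS p))))
    module Tail = Homomorphism (DS-isAbelian p) (DS-isAbelian (s≤s z≤n ∷ p)) (0C ∷_)
      (λ x y → cong (_∷ addDS x y) (sym (Cₘ.identityˡ 0C)))

  signedSum-components : ∀ {j l} (ss₁ : Vec Sign j) (ss₂ : Vec Sign l) xs ys →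
    signedSum G (ss₁ ++ ss₂) (map (_∷ zeroDS p) xs ++ map (0C ∷_) ys)
      ≡ signedSum (CG m) ss₁ xs ∷ signedSum (DSG ms p) ss₂ ys
  signedSum-components ss₁ ss₂ xs ys = begin
    signedSum G (ss₁ ++ ss₂) (map (_∷ zeroDS p) xs ++ map (0C ∷_) ys)
      ≡⟨ signedSum-++ (DS-isAbelian (s≤s z≤n ∷ p)) ss₁ ss₂ _ _ ⟩
    addDS (signedSum G ss₁ (map (_∷ zeroDS p) xs)) (signedSum G ss₂ (map (0C ∷_) ys))
      ≡⟨ cong₂ addDS (Head.signedSum-homo ss₁ xs) (Tail.signedSum-homo ss₂ ys) ⟨
    addDS (a ∷ zeroDS p) (0C ∷ b)
      ≡⟨ cong₂ _∷_ (Cₘ.identityʳ a) (DS.identityˡ b) ⟩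
    a ∷ b ∎
    where
    open ≡-Reasoning
    a = signedSum (CG m) ss₁ xs
    b = signedSum (DSG ms p) ss₂ ys

binarySequence-zeroSumFree : ∀ ms (p : AllPos ms) → ZeroSumFree (DSG ms p) (binarySequence ms p)
binarySequence-zeroSumFree (.(suc m) ∷ ms) (s≤s {n = m} z≤n ∷ p) ss nt sum≡0
  with ss₁ , ss₂ , refl ← splitAt ⌊log₂ suc m ⌋ ss
  with components≡0 ← trans (sym (signedSum-components p ss₁ ss₂ _ _)) sum≡0
  with NonTrivial-++⁻ ss₁ nt
... | inj₁ nt₁ = powersOfTwo-zeroSumFree _ (2^⌊log₂n⌋≤n (s≤s z≤n)) ss₁ nt₁ (cong head components≡0)
... | inj₂ nt₂ = binarySequence-zeroSumFree ms p ss₂ nt₂ (cong tail components≡0)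


-- Counting subset sums

bits : ∀ k → Fin (2 ^ k) → Vec (Fin 2) k
bits zero    _ = []
bits (suc k) i = proj₁ (remQuot {2} (2 ^ k) i) ∷ bits k (proj₂ (remQuot {2} (2 ^ k) i))

bits-injective : ∀ k → Injective _≡_ _≡_ (bits k)
bits-injective zero    {0F} {0F} _ = refl
bits-injective (suc k) {i}  {j}  bits≡ = begin
  i                                  ≡⟨ combine-remQuot {2} (2 ^ k) i ⟨
  uncurry combine (remQuot (2 ^ k) i) ≡⟨ cong (uncurry combine) remQuot≡ ⟩
  uncurry combine (remQuot (2 ^ k) j) ≡⟨ combine-remQuot {2} (2 ^ k) j ⟩
  j                                  ∎
  where
  open ≡-Reasoning
  remQuot≡ : remQuot {2} (2 ^ k) i ≡ remQuot (2 ^ k) j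
  remQuot≡ = cong₂ _,_ (cong Vec.head bits≡) (bits-injective k (cong Vec.tail bits≡))

select : Fin 2 → Sign
select 0F = s0
select 1F = s+

difference : Fin 2 → Fin 2 → Sign
difference 0F 0F = s0
difference 1F 1F = s0
difference 1F 0F = s+
difference 0F 1F = s-

difference-nonTrivial : ∀ {k} (u v : Vec (Fin 2) k) → u ≢ v → NonTrivial (zipWith difference u v)
difference-nonTrivial []       []       u≢v = contradiction refl u≢v
difference-nonTrivial (0F ∷ u) (0F ∷ v) u≢v = there (difference-nonTrivial u v (u≢v ∘ cong (0F ∷_)))
difference-nonTrivial (1F ∷ u) (1F ∷ v) u≢v = there (difference-nonTrivial u v (u≢v ∘ cong (1F ∷_)))
difference-nonTrivial (1F ∷ u) (0F ∷ v) _   = here+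
difference-nonTrivial (0F ∷ u) (1F ∷ v) _   = here-

module _ {G : FinAbGroup} (G-ab : IsAbelian G) where
  open AbelianGroup (abelianGroup G G-ab) using (_∙_; ε; _⁻¹; assoc; identityˡ; inverseˡ; commutativeSemigroup)
  open CommutativeSemigroupProperties commutativeSemigroup using (interchange; x∙yz≈y∙xz)

  subsetSum : ∀ {k} → Vec (Fin 2) k → Vec (Carrier G) k → Carrier G
  subsetSum u gs = signedSum G (map select u) gs

  signedSum-difference : ∀ {k} (u v : Vec (Fin 2) k) gs →
    signedSum G (zipWith difference u v) gs ∙ subsetSum v gs ≡ subsetSum u gs
  signedSum-difference []       []       []       = identityˡ ε
  signedSum-difference (0F ∷ u) (0F ∷ v) (g ∷ gs) = signedSum-difference u v gs
  signedSum-difference (1F ∷ u) (1F ∷ v) (g ∷ gs) =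
    trans (x∙yz≈y∙xz _ g _) (cong (g ∙_) (signedSum-difference u v gs))
  signedSum-difference (1F ∷ u) (0F ∷ v) (g ∷ gs) =
    trans (assoc g _ _) (cong (g ∙_) (signedSum-difference u v gs))
  signedSum-difference (0F ∷ u) (1F ∷ v) (g ∷ gs) = begin
    (g ⁻¹ ∙ D) ∙ (g ∙ subsetSum v gs)   ≡⟨ interchange (g ⁻¹) D g _ ⟩
    (g ⁻¹ ∙ g) ∙ (D ∙ subsetSum v gs)   ≡⟨ cong₂ _∙_ (inverseˡ g) (signedSum-difference u v gs) ⟩
    ε ∙ subsetSum u gs                  ≡⟨ identityˡ _ ⟩
    subsetSum u gs                      ∎
    where
    open ≡-Reasoning
    D = signedSum G (zipWith difference u v) gs

  PMGood-fromInjection : ∀ {M ℓ} (enc : Carrier G → Fin M) → Injective _≡_ _≡_ enc → M < 2 ^ ℓ → PMGood G ℓ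
  PMGood-fromInjection {ℓ = ℓ} enc enc-injective M<2^ℓ k ℓ≤k gs =
    zipWith difference u v , difference-nonTrivial u v u≢v , zeroSum
    where
    f : Fin (2 ^ k) → Fin _
    f i = enc (subsetSum (bits k i) gs)
    collision = pigeonhole (<-≤-trans M<2^ℓ (^-monoʳ-≤ 2 ℓ≤k)) f
    i = proj₁ collision
    j = proj₁ (proj₂ collision)
    u = bits k i
    v = bits k j
    u≢v : u ≢ v
    u≢v = Fin.<⇒≢ (proj₁ (proj₂ (proj₂ collision))) ∘ bits-injective k
    zeroSum : signedSum G (zipWith difference u v) gs ≡ ε
    zeroSum = AbelianGroupProperties.identityˡ-unique (abelianGroup G G-ab) _ _
      (trans (signedSum-difference u v gs) (enc-injective (proj₂ (proj₂ (proj₂ collision)))))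

Dstar≡Dpm-ofSmallOrder : ∀ {G ms M} → IsAbelian G → (p : AllPos ms) → IsoDS G ms →
  (enc : Carrier G → Fin M) → Injective _≡_ _≡_ enc → M < 2 ^ logSum ms →
  IsDstar G (logSum ms) × IsDpm G (logSum ms)
Dstar≡Dpm-ofSmallOrder {G} {ms} G-ab p iso enc enc-injective M<2^D =
  ((ms , p , iso , refl) , λ ms′ p′ iso′ → D*≤ ms′ p′ iso′ good) ,
  m≤n+m 1 _ , good , λ ℓ _ goodℓ → D*≤ ms p iso goodℓ
  where
  good : PMGood G (logSum ms)
  good = PMGood-fromInjection G-ab enc enc-injective M<2^D
  D*≤ : ∀ ms′ → AllPos ms′ → IsoDS G ms′ → ∀ {ℓ} → PMGood G ℓ → logSum ms′ ≤ ℓ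
  D*≤ ms′ p′ iso′ {ℓ} goodℓ = subst (_≤ ℓ) (+-comm 1 (sumLog₂ ms′)) (PMGood⇒length< goodℓ
    (ZeroSumFree-transport G-ab p′ iso′ (binarySequence-zeroSumFree ms′ p′)))


-- The Chinese remainder decomposition

module _ {N M : ℕ} (M∣N : suc M ∣ suc N) where

  ι-*-% : ∀ c a → ι {M} (c * (a % suc N)) ≡ ι (c * a)
  ι-*-% c a = ι-≡ (c * (a % suc N)) (c * a) (sym (begin
    (c * a) % suc M                                   ≡⟨ cong (λ z → (c * z) % suc M) (m≡m%n+[m/n]*n a (suc N)) ⟩
    (c * (a % suc N + a / suc N * suc N)) % suc M     ≡⟨ cong (_% suc M) (distrib c (a % suc N) (a / suc N) (suc N)) ⟩
    (c * (a % suc N) + a / suc N * (c * suc N)) % suc M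
      ≡⟨ %-remove-+ʳ (c * (a % suc N)) (∣n⇒∣m*n (a / suc N) (∣n⇒∣m*n c M∣N)) ⟩
    (c * (a % suc N)) % suc M                         ∎))
    where
    open ≡-Reasoning
    distrib : ∀ c r q n → c * (r + q * n) ≡ c * r + q * (c * n)
    distrib = solve-∀

  linear : ℕ → ℕ → C (suc N) × C (suc N) → C (suc M)
  linear c d (x , y) = ι (c * toℕ x + d * toℕ y)

  linear-homo : ∀ c d u v → linear c d (_⊕_ (Csq N) u v) ≡ addC (linear c d u) (linear c d v)
  linear-homo c d (x , y) (x′ , y′) = begin
    ι (c * toℕ (addC x x′) + d * toℕ (addC y y′))
      ≡⟨ cong₂ (λ a b → ι (c * a + d * b))
               (toℕ-fromℕ< (m%n<n (X + X′) (suc N))) (toℕ-fromℕ< (m%n<n (Y + Y′) (suc N))) ⟩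
    ι (c * ((X + X′) % suc N) + d * ((Y + Y′) % suc N))
      ≡⟨ ι-+ (c * ((X + X′) % suc N)) (d * ((Y + Y′) % suc N)) ⟩
    addC (ι (c * ((X + X′) % suc N))) (ι (d * ((Y + Y′) % suc N)))
      ≡⟨ cong₂ addC (ι-*-% c (X + X′)) (ι-*-% d (Y + Y′)) ⟩
    addC (ι (c * (X + X′))) (ι (d * (Y + Y′)))
      ≡⟨ ι-+ (c * (X + X′)) (d * (Y + Y′)) ⟨
    ι (c * (X + X′) + d * (Y + Y′))
      ≡⟨ cong ι (regroup c d X X′ Y Y′) ⟩
    ι ((c * X + d * Y) + (c * X′ + d * Y′))
      ≡⟨ ι-+ (c * X + d * Y) (c * X′ + d * Y′) ⟩
    addC (ι (c * X + d * Y)) (ι (c * X′ + d * Y′)) ∎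
    where
    open ≡-Reasoning
    X = toℕ x; X′ = toℕ x′; Y = toℕ y; Y′ = toℕ y′
    regroup : ∀ c d x x′ y y′ → c * (x + x′) + d * (y + y′) ≡ (c * x + d * y) + (c * x′ + d * y′)
    regroup = solve-∀

∣∧<⇒≡0 : ∀ {m n} → m ∣ n → n < m → n ≡ 0
∣∧<⇒≡0 {n = zero}  _   _   = refl
∣∧<⇒≡0 {n = suc n} m∣n n<m = contradiction m∣n (>⇒∤ n<m)

coprime-∣-* : ∀ {a b c x} → Coprime c a → Coprime c b → a * b ∣ x → c ∣ x → a * b * c ∣ x
coprime-∣-* {a} {b} {c} c⊥a c⊥b (divides q refl) c∣x = divides (quotient c∣q) (begin
  q * (a * b)                    ≡⟨ cong (_* (a * b)) (m∣n⇒n≡quotient*m c∣q) ⟩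
  quotient c∣q * c * (a * b)     ≡⟨ reassoc′ (quotient c∣q) c a b ⟩
  quotient c∣q * (a * b * c)     ∎)
  where
  open ≡-Reasoning
  reassoc : ∀ q a b → q * (a * b) ≡ a * (b * q)
  reassoc = solve-∀
  reassoc′ : ∀ r c a b → r * c * (a * b) ≡ r * (a * b * c)
  reassoc′ = solve-∀
  c∣q : c ∣ q
  c∣q = coprime-divisor c⊥b (coprime-divisor c⊥a (subst (c ∣_) (reassoc q a b) c∣x))

crt-kernel : ∀ {n₁ n₂ n₃ x y} → Coprime n₁ n₂ → Coprime n₁ n₃ → Coprime n₂ n₃ →
  n₁ * n₂ ∣ x → n₁ * n₃ ∣ y → n₂ * n₃ ∣ n₂ * x + n₃ * y →
  n₁ * n₂ * n₃ ∣ x × n₁ * n₂ * n₃ ∣ y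
crt-kernel {n₁} {n₂} {n₃} {x} {y} c₁₂ c₁₃ c₂₃ n₁n₂∣x n₁n₃∣y n₂n₃∣z =
  coprime-∣-* (Coprime.sym c₁₃) (Coprime.sym c₂₃) n₁n₂∣x n₃∣x ,
  subst (_∣ y) (swap n₁ n₃ n₂) (coprime-∣-* (Coprime.sym c₁₂) c₂₃ n₁n₃∣y n₂∣y)
  where
  n₃∣x : n₃ ∣ x
  n₃∣x = coprime-divisor (Coprime.sym c₂₃)
    (∣m+n∣m⇒∣n (subst (n₃ ∣_) (+-comm (n₂ * x) _) (∣-trans (n∣m*n n₂) n₂n₃∣z)) (m∣m*n y))
  n₂∣y : n₂ ∣ y
  n₂∣y = coprime-divisor c₂₃ (∣m+n∣m⇒∣n (∣-trans (m∣m*n n₃) n₂n₃∣z) (m∣m*n x))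
  swap : ∀ a b c → a * b * c ≡ a * c * b
  swap = solve-∀

Fin-injective⇒surjective : ∀ {n} (f : Fin n → Fin n) → Injective _≡_ _≡_ f → ∀ y → ∃ λ x → f x ≡ y
Fin-injective⇒surjective f f-injective y with any? (λ x → f x Fin.≟ y)
... | yes found   = found
Fin-injective⇒surjective {suc n} f f-injective y | no ¬found =
  contradiction (injective⇒≤ punch-injective) (n≮n n)
  where
  y≢f : ∀ x → y ≢ f x
  y≢f x y≡fx = ¬found (x , sym y≡fx)
  punch-injective : Injective _≡_ _≡_ (λ x → punchOut (y≢f x))
  punch-injective = f-injective ∘ punchOut-injective (y≢f _) (y≢f _)

injective⇒rightInverse : ∀ {A B : Set} {m n} → m ≡ n →
  (dec : Fin m → A) → Injective _≡_ _≡_ dec → (enc : B → Fin n) → Injective _≡_ _≡_ enc →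
  (f : A → B) → Injective _≡_ _≡_ f → Σ (B → A) λ g → ∀ y → f (g y) ≡ y
injective⇒rightInverse refl dec dec-injective enc enc-injective f f-injective =
  (λ y → dec (preimage y)) , λ y → enc-injective (proj₂ (surjective (enc y)))
  where
  surjective = Fin-injective⇒surjective (enc ∘ f ∘ dec) (dec-injective ∘ f-injective ∘ enc-injective)
  preimage = λ y → proj₁ (surjective (enc y))

encodeDS : ∀ {ms} → DS ms → Fin (product ms)
encodeDS []       = 0F
encodeDS (a ∷ as) = combine a (encodeDS as)

encodeDS-injective : ∀ {ms} → Injective _≡_ _≡_ (encodeDS {ms})
encodeDS-injective {x = []}     {[]}     _ = refl
encodeDS-injective {x = a ∷ as} {b ∷ bs} eq =
  cong₂ _∷_ (proj₁ (combine-injective a _ b _ eq)) (encodeDS-injective (proj₂ (combine-injective a _ b _ eq)))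

remQuot-injective : ∀ {m} n → Injective _≡_ _≡_ (remQuot {m} n)
remQuot-injective {m} n {i} {j} eq =
  trans (sym (combine-remQuot {m} n i)) (trans (cong (uncurry combine) eq) (combine-remQuot {m} n j))

IsoDS-fromInjectiveHomo : ∀ {G ms n} (to : Carrier G → DS ms) → (∀ x y → to (_⊕_ G x y) ≡ addDS (to x) (to y)) →
  Injective _≡_ _≡_ to → n ≡ product ms → (dec : Fin n → Carrier G) → Injective _≡_ _≡_ dec → IsoDS G ms
IsoDS-fromInjectiveHomo to to-hom to-injective size dec dec-injective = record
  { to      = to
  ; from    = proj₁ rightInverse
  ; from-to = λ x → to-injective (proj₂ rightInverse (to x))
  ; to-from = proj₂ rightInverse
  ; to-hom  = to-hom
  }
  where
  rightInverse = injective⇒rightInverse size dec dec-injective encodeDS encodeDS-injective to to-injective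

-- The decomposition (x , y) ↦ (x mod n₁n₂ , y mod n₁n₃ , n₂x + n₃y mod n₂n₃); it has trivial kernel
-- by crt-kernel, and is bijective since both sides have (n₁n₂n₃)² elements.
module ChineseRemainder {a b c k : ℕ} (N≡ : suc k ≡ suc a * suc b * suc c)
  (c₁₂ : Coprime (suc a) (suc b)) (c₁₃ : Coprime (suc a) (suc c)) (c₂₃ : Coprime (suc b) (suc c)) where

  n₁ n₂ n₃ N : ℕ
  n₁ = suc a
  n₂ = suc b
  n₃ = suc c
  N = suc k

  ms : List ℕ
  ms = n₁ * n₂ ∷ n₁ * n₃ ∷ n₂ * n₃ ∷ []

  ms-positive : AllPos ms
  ms-positive = s≤s z≤n ∷ s≤s z≤n ∷ s≤s z≤n ∷ []

  n₁n₂∣N : n₁ * n₂ ∣ N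
  n₁n₂∣N = subst (n₁ * n₂ ∣_) (sym N≡) (m∣m*n n₃)

  n₁n₃∣N : n₁ * n₃ ∣ N
  n₁n₃∣N = subst (n₁ * n₃ ∣_) (sym (trans N≡ (swap n₁ n₂ n₃))) (m∣m*n n₂)
    where
    swap : ∀ x y z → x * y * z ≡ x * z * y
    swap = solve-∀

  n₂n₃∣N : n₂ * n₃ ∣ N
  n₂n₃∣N = subst (n₂ * n₃ ∣_) (sym (trans N≡ (*-assoc n₁ n₂ n₃))) (n∣m*n n₁)

  toDS : Carrier (Csq k) → DS ms
  toDS u = linear n₁n₂∣N 1 0 u ∷ linear n₁n₃∣N 0 1 u ∷ linear n₂n₃∣N n₂ n₃ u ∷ []

  toDS-homo : ∀ u v → toDS (_⊕_ (Csq k) u v) ≡ addDS (toDS u) (toDS v)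
  toDS-homo u v = cong₂ _∷_ (linear-homo n₁n₂∣N 1 0 u v)
    (cong₂ _∷_ (linear-homo n₁n₃∣N 0 1 u v) (cong (_∷ []) (linear-homo n₂n₃∣N n₂ n₃ u v)))

  toDS-kernel : ∀ u → toDS u ≡ zeroDS ms-positive → u ≡ (0C , 0C)
  toDS-kernel (x , y) toDS≡0 =
    cong₂ _,_ (toℕ-injective (∣∧<⇒≡0 N∣X (toℕ<n x))) (toℕ-injective (∣∧<⇒≡0 N∣Y (toℕ<n y)))
    where
    X = toℕ x
    Y = toℕ y
    n₁n₂∣X : n₁ * n₂ ∣ X
    n₁n₂∣X = subst (n₁ * n₂ ∣_) (trans (+-identityʳ (1 * X)) (*-identityˡ X)) (ι≡0C⇒∣ _ (cong head toDS≡0))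
    n₁n₃∣Y : n₁ * n₃ ∣ Y
    n₁n₃∣Y = subst (n₁ * n₃ ∣_) (*-identityˡ Y) (ι≡0C⇒∣ _ (cong (head ∘ tail) toDS≡0))
    n₂n₃∣n₂X+n₃Y : n₂ * n₃ ∣ n₂ * X + n₃ * Y
    n₂n₃∣n₂X+n₃Y = ι≡0C⇒∣ _ (cong (head ∘ tail ∘ tail) toDS≡0)
    n₁n₂n₃∣X×Y = crt-kernel c₁₂ c₁₃ c₂₃ n₁n₂∣X n₁n₃∣Y n₂n₃∣n₂X+n₃Y
    N∣X = subst (_∣ X) (sym N≡) (proj₁ n₁n₂n₃∣X×Y)
    N∣Y = subst (_∣ Y) (sym N≡) (proj₂ n₁n₂n₃∣X×Y)

  size : N * N ≡ product ms
  size = trans (cong (λ n → n * n) N≡) (square n₁ n₂ n₃)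
    where
    square : ∀ x y z → x * y * z * (x * y * z) ≡ x * y * (x * z * (y * z * 1))
    square = solve-∀

  decomposition : IsoDS (Csq k) ms
  decomposition = IsoDS-fromInjectiveHomo toDS toDS-homo
    (Homomorphism.trivialKernel⇒injective (Csq-isAbelian k) (DS-isAbelian ms-positive) toDS toDS-homo toDS-kernel)
    size (remQuot N) (remQuot-injective N)


theorem3p6 : (n₁ n₂ n₃ : ℕ) → 1 ≤ n₁ → 1 ≤ n₂ → 1 ≤ n₃ →
    Coprime n₁ n₂ → Coprime n₁ n₃ → Coprime n₂ n₃ →
    FracSum2≥1 n₁ n₂ → FracSum2≥1 n₁ n₃ → FracSum2≥1 n₂ n₃ →
    FracSum3<2 n₁ n₂ n₃ →
    (k : ℕ) → suc k ≡ n₁ * n₂ * n₃ →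
    IsDstar (Csq k) (⌊log₂ (n₁ * n₂ * n₃ * (n₁ * n₂ * n₃)) ⌋ + 1) ×
    IsDpm (Csq k) (⌊log₂ (n₁ * n₂ * n₃ * (n₁ * n₂ * n₃)) ⌋ + 1)
theorem3p6 n₁@(suc a) n₂@(suc b) n₃@(suc c) 1≤n₁@(s≤s z≤n) 1≤n₂@(s≤s z≤n) 1≤n₃@(s≤s z≤n)
  c₁₂ c₁₃ c₂₃ carry₁₂ carry₁₃ carry₂₃ N<2^s k N≡ =
  subst (λ D → IsDstar (Csq k) D × IsDpm (Csq k) D) D*≡
    (Dstar≡Dpm-ofSmallOrder (Csq-isAbelian k) ms-positive decomposition (uncurry combine) combine-injective′ order<2^D*)
  where
  open ChineseRemainder N≡ c₁₂ c₁₃ c₂₃ using (ms; ms-positive; decomposition)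
  N = n₁ * n₂ * n₃
  log≡ : ⌊log₂ (N * N) ⌋ ≡ sumLog₂ ms
  log≡ = ⌊log₂[n₁n₂n₃]²⌋≡sumLog₂ 1≤n₁ 1≤n₂ 1≤n₃ carry₁₂ carry₁₃ carry₂₃ N<2^s
  D*≡ : logSum ms ≡ ⌊log₂ (N * N) ⌋ + 1
  D*≡ = cong (_+ 1) (sym log≡)
  order<2^D* : suc k * suc k < 2 ^ logSum ms
  order<2^D* = subst₂ (λ n e → n * n < 2 ^ e) (sym N≡) (trans (cong suc log≡) (+-comm 1 _))
    (n<2^[1+⌊log₂n⌋] (N * N))
  combine-injective′ : Injective _≡_ _≡_ (uncurry (combine {suc k} {suc k}))
  combine-injective′ {x , y} {x′ , y′} eq = uncurry (cong₂ _,_) (combine-injective x y x′ y′ eq)
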